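{- Let $G$ be a graph with an even Hamiltonian circuit $C$ such that the spanning subgraph $G\setminus E(C)$ is bipartite. If $G\setminus E(C)$ has an oriented cycle double cover, then $G$ has a $2$-simultaneous edge coloring.
   Context: All graphs are finite and simple; $[l]=\{1,\ldots,l\}$. A circuit is a connected $2$-regular subgraph; an even Hamiltonian circuit is a circuit through all vertices of $G$ of even length. An oriented cycle double cover of a graph $H$ is a collection (multiset) of circuits of $H$ such that every edge of $H$ lies in exactly two of them, and each circuit can be given a cyclic orientation so that every edge of $H$ is traversed by its two covering directed circuits in opposite directions. A $2$-simultaneous edge coloring of $G$ is a pair $(c_1,c_2)$ of proper edge colorings $c_i:E(G)\to[l]$ with a common color set such that for every vertex $v$ the sets of colors on edges incident to $v$ are the same under $c_1$ and $c_2$, and $c_1(e)\ne c_2(e)$ for every edge $e$. -}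

module Defs where

open import Level using (0ℓ)
open import Data.Nat using (ℕ; zero; suc; _≤_)
open import Data.Nat.Divisibility using (_∣_)
open import Data.Fin using (Fin; toℕ)
open import Data.Bool using (Bool)
open import Data.Product using (Σ; ∃; ∃-syntax; _×_; _,_)
open import Data.Sum using (_⊎_)
open import Relation.Nullary using (¬_)
open import Relation.Binary.PropositionalEquality using (_≡_; _≢_)
open import Function.Bundles using (_⇔_)

record Graph : Set₁ where
  field
    n    : ℕ
    Adj  : Fin n → Fin n → Set
    sym  : ∀ {u v} → Adj u v → Adj v u
    irr  : ∀ {u} → ¬ Adj u u

open Graph public

Step : (k : ℕ) → Fin k → Fin k → Set
Step k i j = (suc (toℕ i) ≡ toℕ j) ⊎ (suc (toℕ i) ≡ k × toℕ j ≡ 0)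

-- A circuit (connected 2-regular subgraph) of G, given with a cyclic order
-- (hence an orientation) of its vertices: k ≥ 3 distinct vertices
-- w 0, ..., w (k-1), consecutive ones (cyclically) adjacent in G.
record Circuit (G : Graph) : Set where
  field
    len     : ℕ
    len≥3   : 3 ≤ len
    vtx     : Fin len → Fin (n G)
    inj     : ∀ i j → vtx i ≡ vtx j → i ≡ j
    adj     : ∀ i j → Step len i j → Adj G (vtx i) (vtx j)

open Circuit public

HasArc : {G : Graph} → Circuit G → Fin (n G) → Fin (n G) → Set
HasArc C u v = ∃[ i ] ∃[ j ] (Step (len C) i j × vtx C i ≡ u × vtx C j ≡ v)

HasEdge : {G : Graph} → Circuit G → Fin (n G) → Fin (n G) → Set
HasEdge C u v = HasArc C u v ⊎ HasArc C v u

record EvenHamCircuit (G : Graph) : Set where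
  field
    circ     : Circuit G
    spanning : ∀ v → ∃[ i ] (vtx circ i ≡ v)
    even     : 2 ∣ len circ

open EvenHamCircuit public

_∖E_ : (G : Graph) → Circuit G → Graph
G ∖E C = record
  { n   = n G
  ; Adj = λ u v → Adj G u v × ¬ HasEdge C u v
  ; sym = λ { (a , h) → sym G a , λ { (Data.Sum.inj₁ x) → h (Data.Sum.inj₂ x)
                                     ; (Data.Sum.inj₂ x) → h (Data.Sum.inj₁ x) } }
  ; irr = λ { (a , _) → irr G a }
  }

Bipartite : Graph → Set
Bipartite G = Σ (Fin (n G) → Bool) λ f → ∀ u v → Adj G u v → f u ≢ f v

ExactlyOne : (m : ℕ) → (Fin m → Set) → Set
ExactlyOne m P = ∃[ a ] (P a × ∀ b → P b → b ≡ a)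

-- oriented cycle double cover: a finite family (multiset) of circuits, each
-- with a chosen cyclic orientation, such that for every edge uv, exactly one
-- member traverses u → v and exactly one traverses v → u (so every edge lies
-- in exactly two members, traversed in opposite directions).
OrientedCDC : Graph → Set
OrientedCDC H =
  Σ ℕ λ m → Σ (Fin m → Circuit H) λ D →
    ∀ u v → Adj H u v → ExactlyOne m (λ a → HasArc (D a) u v)

-- edge colorings as symmetric functions on vertex pairs (only values on
-- edges matter)
record EdgeColoring (G : Graph) (l : ℕ) : Set where
  field
    col    : Fin (n G) → Fin (n G) → Fin l
    colSym : ∀ u v → Adj G u v → col u v ≡ col v u
    proper : ∀ u v w → Adj G u v → Adj G u w → v ≢ w → col u v ≢ col u w

open EdgeColoring public

ColorAt : {G : Graph} {l : ℕ} → EdgeColoring G l → Fin (n G) → Fin l → Set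
ColorAt {G} c v k = ∃[ u ] (Adj G v u × col c v u ≡ k)

TwoSimultaneousEdgeColoring : Graph → Set
TwoSimultaneousEdgeColoring G =
  Σ ℕ λ l → Σ (EdgeColoring G l) λ c₁ → Σ (EdgeColoring G l) λ c₂ →
    (∀ v k → ColorAt c₁ v k ⇔ ColorAt c₂ v k) ×
    (∀ u v → Adj G u v → col c₁ u v ≢ col c₂ u v)

-- Colour the edges of C alternately 0, 1 (C is even) and take the swapped colouring as the
-- second one; every vertex of C then sees both colours under both colourings. Colour an edge uv
-- of the bipartite graph G ∖ E(C) by the circuit of the cover that traverses it from its end in
-- one colour class (first colouring) or in the other (second colouring). Each circuit passes a
-- vertex at most once and leaves it as often as it enters it, which gives properness and equal
-- colour sets; the two circuits through uv traverse it in opposite directions, so the two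
-- colours of uv differ. Combining both parts on disjoint palettes colours G.
module Submission where

open import Defs hiding (sym)
open import Data.Bool using (Bool; true; false; not; _xor_)
open import Data.Bool.Properties using (¬-not; not-distribˡ-xor; not-distribʳ-xor)
open import Data.Fin using (Fin; toℕ; zero; suc; fromℕ; fromℕ<; inject₁; _↑ˡ_; _↑ʳ_; splitAt)
open import Data.Fin.Properties
  using (any?; toℕ-injective; toℕ<n; toℕ-fromℕ; toℕ-fromℕ<; toℕ-inject₁;
         ↑ˡ-injective; ↑ʳ-injective; splitAt-↑ˡ; splitAt-↑ʳ)
import Data.Fin.Properties as Fin
open import Data.Nat using (ℕ; zero; suc; _+_; _*_; _≤_; s≤s; _≟_; parity)
open import Data.Nat.Divisibility using (_∣_; divides)
open import Data.Nat.Properties using (suc-injective; m≤n⇒m<n∨m≡n; <-irrefl; m≢1+n+m)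
open import Data.Parity.Base as ℙ using (Parity; 0ℙ; 1ℙ; _⁻¹)
open import Data.Parity.Properties
  using (⁻¹-selfInverse; suc-homo-⁻¹; *-homo-*; *-zeroʳ; +-cancelˡ-≡; p≢p⁻¹)
open import Data.Product using (∃-syntax; _×_; _,_)
open import Data.Sum using (_⊎_; inj₁; inj₂; [_,_]; swap)
open import Function using (_∘_; _∘₂_)
open import Function.Bundles using (_⇔_; mk⇔; Equivalence)
open import Relation.Nullary using (¬_; Dec; yes; no; contradiction)
open import Relation.Nullary.Decidable using (_×-dec_; _⊎-dec_)
open import Relation.Binary.PropositionalEquality
  using (_≡_; _≢_; refl; sym; trans; cong; subst; module ≡-Reasoning)

open Equivalence using (to; from)

Step-functional : ∀ {k} {i j j′ : Fin k} → Step k i j → Step k i j′ → j ≡ j′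
Step-functional (inj₁ p) (inj₁ q) = toℕ-injective (trans (sym p) q)
Step-functional {j = j} (inj₁ p) (inj₂ (q , _)) =
  contradiction (toℕ<n j) (<-irrefl (trans (sym p) q))
Step-functional {j′ = j′} (inj₂ (q , _)) (inj₁ p) =
  contradiction (toℕ<n j′) (<-irrefl (trans (sym p) q))
Step-functional (inj₂ (_ , p)) (inj₂ (_ , q)) = toℕ-injective (trans p (sym q))

Step-injective : ∀ {k} {i i′ j : Fin k} → Step k i j → Step k i′ j → i ≡ i′
Step-injective (inj₁ p) (inj₁ q) = toℕ-injective (suc-injective (trans p (sym q)))
Step-injective (inj₁ p) (inj₂ (_ , q)) = contradiction (trans p q) λ ()
Step-injective (inj₂ (_ , q)) (inj₁ p) = contradiction (trans p q) λ ()
Step-injective (inj₂ (p , _)) (inj₂ (q , _)) = toℕ-injective (suc-injective (trans p (sym q)))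

Step-successor : ∀ {k} (i : Fin k) → ∃[ j ] Step k i j
Step-successor {k = suc k′} i with m≤n⇒m<n∨m≡n (toℕ<n i)
... | inj₁ i+1<k = fromℕ< i+1<k , inj₁ (sym (toℕ-fromℕ< i+1<k))
... | inj₂ i+1≡k = zero , inj₂ (i+1≡k , refl)

Step-predecessor : ∀ {k} (j : Fin k) → ∃[ i ] Step k i j
Step-predecessor {suc k′} zero = fromℕ k′ , inj₂ (cong suc (toℕ-fromℕ k′) , refl)
Step-predecessor {suc k′} (suc j) = inject₁ j , inj₁ (cong suc (toℕ-inject₁ j))

step? : ∀ {k} (i j : Fin k) → Dec (Step k i j)
step? {k} i j = (suc (toℕ i) ≟ toℕ j) ⊎-dec ((suc (toℕ i) ≟ k) ×-dec (toℕ j ≟ 0))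

parity-suc : ∀ n → parity (suc n) ≡ parity n ⁻¹
parity-suc n = sym (⁻¹-selfInverse (suc-homo-⁻¹ n))

Step-parity : ∀ {k} → 2 ∣ k → ∀ {i j : Fin k} → Step k i j → parity (toℕ j) ≡ parity (toℕ i) ⁻¹
Step-parity _ {i} (inj₁ i+1≡j) = trans (cong parity (sym i+1≡j)) (parity-suc (toℕ i))
Step-parity (divides q refl) {i} {j} (inj₂ (i+1≡k , j≡0)) = begin
  parity (toℕ j)       ≡⟨ cong parity j≡0 ⟩
  0ℙ                   ≡⟨ sym (*-zeroʳ (parity q)) ⟩
  parity q ℙ.* 0ℙ      ≡⟨ sym (*-homo-* q 2) ⟩
  parity (q * 2)       ≡⟨ cong parity (sym i+1≡k) ⟩
  parity (suc (toℕ i)) ≡⟨ parity-suc (toℕ i) ⟩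
  parity (toℕ i) ⁻¹    ∎
  where open ≡-Reasoning

Step-asymmetric : ∀ {k} → 3 ≤ k → ∀ {i j : Fin k} → Step k i j → ¬ Step k j i
Step-asymmetric (s≤s (s≤s (s≤s _))) = asym
  where
  -- Step restated on the underlying naturals, so that its equations can be matched on.
  asym : ∀ {k x y} → (suc x ≡ y) ⊎ (suc x ≡ suc (suc (suc k)) × y ≡ 0) →
         ¬ ((suc y ≡ x) ⊎ (suc y ≡ suc (suc (suc k)) × x ≡ 0))
  asym (inj₁ refl) (inj₁ q) = m≢1+n+m _ (sym q)
  asym (inj₁ refl) (inj₂ (() , refl))
  asym (inj₂ (() , refl)) (inj₁ refl)
  asym (inj₂ (() , refl)) (inj₂ (_ , refl))

module _ {G : Graph} (C : Circuit G) where

  HasArc-functional : ∀ {u v w} → HasArc C u v → HasArc C u w → v ≡ w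
  HasArc-functional (i , j , s , refl , refl) (i′ , j′ , s′ , i′↦u , refl)
    with refl ← inj C i′ i i′↦u = cong (vtx C) (Step-functional s s′)

  HasArc-injective : ∀ {u v w} → HasArc C v u → HasArc C w u → v ≡ w
  HasArc-injective (i , j , s , refl , refl) (i′ , j′ , s′ , refl , j′↦u)
    with refl ← inj C j′ j j′↦u = cong (vtx C) (Step-injective s s′)

  HasArc-asym : ∀ {u v} → HasArc C u v → ¬ HasArc C v u
  HasArc-asym (i , j , s , refl , refl) (i′ , j′ , s′ , i′↦v , j′↦u)
    with refl ← inj C i′ j i′↦v | refl ← inj C j′ i j′↦u = Step-asymmetric (len≥3 C) s s′

  hasArc? : ∀ u v → Dec (HasArc C u v)
  hasArc? u v = any? λ i → any? λ j →
    step? i j ×-dec (vtx C i Fin.≟ u ×-dec vtx C j Fin.≟ v)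

  hasEdge? : ∀ u v → Dec (HasEdge C u v)
  hasEdge? u v = hasArc? u v ⊎-dec hasArc? v u

  HasArc⇒Adj : ∀ {u v} → HasArc C u v → Adj G u v
  HasArc⇒Adj (i , j , s , refl , refl) = adj C i j s

  HasEdge⇒Adj : ∀ {u v} → HasEdge C u v → Adj G u v
  HasEdge⇒Adj = [ HasArc⇒Adj , Graph.sym G ∘ HasArc⇒Adj ]

  outArc : ∀ {i v} → vtx C i ≡ v → ∃[ w ] HasArc C v w
  outArc {i} i↦v = let j , s = Step-successor i in vtx C j , i , j , s , i↦v , refl

  inArc : ∀ {i v} → vtx C i ≡ v → ∃[ w ] HasArc C w v
  inArc {i} i↦v = let j , s = Step-predecessor i in vtx C j , j , i , s , refl , i↦v

  HasEdge⇒onCircuit : ∀ {u v} → HasEdge C u v → ∃[ i ] vtx C i ≡ u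
  HasEdge⇒onCircuit (inj₁ (i , _ , _ , i↦u , _)) = i , i↦u
  HasEdge⇒onCircuit (inj₂ (_ , j , _ , _ , j↦u)) = j , j↦u

circuitGraph : {G : Graph} → Circuit G → Graph
circuitGraph {G} C = record
  { n   = n G
  ; Adj = HasEdge C
  ; sym = swap
  ; irr = irr G ∘ HasEdge⇒Adj C
  }

toFin : Parity → Fin 2
toFin 0ℙ = zero
toFin 1ℙ = suc zero

toFin-injective : ∀ {p q} → toFin p ≡ toFin q → p ≡ q
toFin-injective {0ℙ} {0ℙ} _ = refl
toFin-injective {1ℙ} {1ℙ} _ = refl

toFin-⁻¹-surjective : ∀ p k → toFin p ≡ k ⊎ toFin (p ⁻¹) ≡ k
toFin-⁻¹-surjective 0ℙ zero       = inj₁ refl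
toFin-⁻¹-surjective 0ℙ (suc zero) = inj₂ refl
toFin-⁻¹-surjective 1ℙ zero       = inj₂ refl
toFin-⁻¹-surjective 1ℙ (suc zero) = inj₁ refl

+-⁻¹ : ∀ p q → p ℙ.+ q ⁻¹ ≡ (p ℙ.+ q) ⁻¹
+-⁻¹ 0ℙ q = refl
+-⁻¹ 1ℙ q = refl

module EvenCircuit {G : Graph} (C : Circuit G) (even : 2 ∣ len C) where

  -- 0ℙ is a junk value for vertices not on C.
  vertexParity : Fin (n G) → Parity
  vertexParity u with any? (λ i → vtx C i Fin.≟ u)
  ... | yes (i , _) = parity (toℕ i)
  ... | no _        = 0ℙ

  vertexParity-vtx : ∀ i → vertexParity (vtx C i) ≡ parity (toℕ i)
  vertexParity-vtx i with any? (λ i′ → vtx C i′ Fin.≟ vtx C i)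
  ... | yes (i′ , i′↦) = cong (parity ∘ toℕ) (inj C i′ i i′↦)
  ... | no ¬found      = contradiction (i , refl) ¬found

  HasArc-parity : ∀ {u v} → HasArc C u v → vertexParity u ⁻¹ ≡ vertexParity v
  HasArc-parity (i , j , s , refl , refl) = begin
    vertexParity (vtx C i) ⁻¹ ≡⟨ cong _⁻¹ (vertexParity-vtx i) ⟩
    parity (toℕ i) ⁻¹         ≡⟨ Step-parity even s ⟨
    parity (toℕ j)            ≡⟨ vertexParity-vtx j ⟨
    vertexParity (vtx C j)    ∎
    where open ≡-Reasoning

  tailParity : Fin (n G) → Fin (n G) → Parity
  tailParity u v with hasArc? C u v
  ... | yes _ = vertexParity u
  ... | no _  = vertexParity v

  tailParity-out : ∀ {u v} → HasArc C u v → tailParity u v ≡ vertexParity u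
  tailParity-out {u} {v} u↦v with hasArc? C u v
  ... | yes _   = refl
  ... | no ¬u↦v = contradiction u↦v ¬u↦v

  tailParity-in : ∀ {u v} → HasArc C v u → tailParity u v ≡ vertexParity u ⁻¹
  tailParity-in {u} {v} v↦u with hasArc? C u v
  ... | yes u↦v = contradiction v↦u (HasArc-asym C u↦v)
  ... | no _    = sym (⁻¹-selfInverse (HasArc-parity v↦u))

  tailParity-sym : ∀ {u v} → HasEdge C u v → tailParity u v ≡ tailParity v u
  tailParity-sym (inj₁ u↦v) =
    trans (tailParity-out u↦v)
          (sym (trans (tailParity-in u↦v) (⁻¹-selfInverse (HasArc-parity u↦v))))
  tailParity-sym (inj₂ v↦u) = sym (tailParity-sym (inj₁ v↦u))

  tailParity-injective : ∀ {u v w} → HasEdge C u v → HasEdge C u w →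
                         tailParity u v ≡ tailParity u w → v ≡ w
  tailParity-injective (inj₁ u↦v) (inj₁ u↦w) _ = HasArc-functional C u↦v u↦w
  tailParity-injective (inj₂ v↦u) (inj₂ w↦u) _ = HasArc-injective C v↦u w↦u
  tailParity-injective (inj₁ u↦v) (inj₂ w↦u) eq =
    contradiction (trans (sym (tailParity-out u↦v)) (trans eq (tailParity-in w↦u))) (p≢p⁻¹ _)
  tailParity-injective (inj₂ v↦u) (inj₁ u↦w) eq =
    contradiction (trans (sym (tailParity-out u↦w)) (trans (sym eq) (tailParity-in v↦u))) (p≢p⁻¹ _)

  colouring : Parity → EdgeColoring (circuitGraph C) 2
  colouring b = record
    { col    = λ u v → toFin (b ℙ.+ tailParity u v)
    ; colSym = λ u v uv → cong (toFin ∘ (b ℙ.+_)) (tailParity-sym uv)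
    ; proper = λ u v w uv uw v≢w →
        v≢w ∘ tailParity-injective uv uw ∘ +-cancelˡ-≡ b _ _ ∘ toFin-injective
    }

  allColoursAt : ∀ b {i v} → vtx C i ≡ v → ∀ k → ColorAt (colouring b) v k
  allColoursAt b {v = v} i↦v k with outArc C i↦v | inArc C i↦v
  ... | w , v↦w | w′ , w′↦v with toFin-⁻¹-surjective (b ℙ.+ vertexParity v) k
  ...   | inj₁ eq = w , inj₁ v↦w , trans (cong (toFin ∘ (b ℙ.+_)) (tailParity-out v↦w)) eq
  ...   | inj₂ eq = w′ , inj₂ w′↦v , (begin
    toFin (b ℙ.+ tailParity v w′)     ≡⟨ cong (toFin ∘ (b ℙ.+_)) (tailParity-in w′↦v) ⟩
    toFin (b ℙ.+ vertexParity v ⁻¹)   ≡⟨ cong toFin (+-⁻¹ b (vertexParity v)) ⟩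
    toFin ((b ℙ.+ vertexParity v) ⁻¹) ≡⟨ eq ⟩
    k                                 ∎)
    where open ≡-Reasoning

  twoSimultaneous : TwoSimultaneousEdgeColoring (circuitGraph C)
  twoSimultaneous = 2 , colouring 0ℙ , colouring 1ℙ , sameColours , distinct
    where
    recolour : ∀ b b′ v k → ColorAt (colouring b) v k → ColorAt (colouring b′) v k
    recolour b b′ v k (_ , vu , _) =
      let i , i↦v = HasEdge⇒onCircuit C vu in allColoursAt b′ i↦v k
    sameColours : ∀ v k → ColorAt (colouring 0ℙ) v k ⇔ ColorAt (colouring 1ℙ) v k
    sameColours = λ v k → mk⇔ (recolour 0ℙ 1ℙ v k) (recolour 1ℙ 0ℙ v k)
    distinct : ∀ u v → HasEdge C u v → toFin (tailParity u v) ≢ toFin (tailParity u v ⁻¹)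
    distinct u v _ = p≢p⁻¹ _ ∘ toFin-injective

module BipartiteCover {H : Graph} (side : Fin (n H) → Bool)
  (side-proper : ∀ u v → Adj H u v → side u ≢ side v)
  (m : ℕ) (D : Fin m → Circuit H)
  (cover : ∀ u v → Adj H u v → ExactlyOne m (λ a → HasArc (D a) u v)) where

  -- zero is a junk value for non-arcs (m may be 0); circuit a is the colour suc a.
  arcCircuit : Fin (n H) → Fin (n H) → Fin (suc m)
  arcCircuit u v with any? (λ a → hasArc? (D a) u v)
  ... | yes (a , _) = suc a
  ... | no _        = zero

  arcCircuit-correct : ∀ {u v a} → Adj H u v → HasArc (D a) u v → arcCircuit u v ≡ suc a
  arcCircuit-correct {u} {v} {a} uv u↦v with any? (λ a → hasArc? (D a) u v) | cover u v uv
  ... | yes (a′ , u↦′v) | _ , _ , unique =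
    cong suc (trans (unique a′ u↦′v) (sym (unique a u↦v)))
  ... | no ¬found       | _              = contradiction (a , u↦v) ¬found

  arcCircuit-witness : ∀ {u v} → Adj H u v → ∃[ a ] (HasArc (D a) u v × arcCircuit u v ≡ suc a)
  arcCircuit-witness uv with cover _ _ uv
  ... | a , u↦v , _ = a , u↦v , arcCircuit-correct uv u↦v

  arcCircuit-shared : ∀ {u v u′ v′} → Adj H u v → Adj H u′ v′ → arcCircuit u v ≡ arcCircuit u′ v′ →
                      ∃[ a ] (HasArc (D a) u v × HasArc (D a) u′ v′)
  arcCircuit-shared uv u′v′ eq with arcCircuit-witness uv | arcCircuit-witness u′v′
  ... | a , u↦v , p | _ , u′↦v′ , q with refl ← Fin.suc-injective (trans (sym p) (trans eq q)) =
    a , u↦v , u′↦v′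

  arcCircuit-reverse : ∀ {u v} → Adj H u v → arcCircuit u v ≢ arcCircuit v u
  arcCircuit-reverse uv eq =
    let a , u↦v , v↦u = arcCircuit-shared uv (Graph.sym H uv) eq in HasArc-asym (D a) u↦v v↦u

  orientedCircuit : Bool → Fin (n H) → Fin (n H) → Fin (suc m)
  orientedCircuit true  u v = arcCircuit u v
  orientedCircuit false u v = arcCircuit v u

  orientedCircuit-flip : ∀ x u v → orientedCircuit x u v ≡ orientedCircuit (not x) v u
  orientedCircuit-flip true  u v = refl
  orientedCircuit-flip false u v = refl

  orientedCircuit-not : ∀ x {u v} → Adj H u v → orientedCircuit x u v ≢ orientedCircuit (not x) u v
  orientedCircuit-not true  uv = arcCircuit-reverse uv
  orientedCircuit-not false uv = arcCircuit-reverse uv ∘ sym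

  orientedCircuit-injective : ∀ x {u v w} → Adj H u v → Adj H u w →
                              orientedCircuit x u v ≡ orientedCircuit x u w → v ≡ w
  orientedCircuit-injective true uv uw eq =
    let a , u↦v , u↦w = arcCircuit-shared uv uw eq in HasArc-functional (D a) u↦v u↦w
  orientedCircuit-injective false uv uw eq =
    let a , v↦u , w↦u = arcCircuit-shared (Graph.sym H uv) (Graph.sym H uw) eq
    in  HasArc-injective (D a) v↦u w↦u

  -- A circuit of the cover that leaves v also enters v, and conversely.
  orientedCircuit-balanced : ∀ x {v k} → ∃[ u ] (Adj H v u × orientedCircuit x v u ≡ k) →
                             ∃[ u ] (Adj H v u × orientedCircuit (not x) v u ≡ k)
  orientedCircuit-balanced true (u , vu , eq) with arcCircuit-witness vu
  ... | a , (i , _ , _ , i↦v , _) , p with inArc (D a) i↦v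
  ...   | w , w↦v = let wv = HasArc⇒Adj (D a) w↦v in
    w , Graph.sym H wv , trans (arcCircuit-correct wv w↦v) (trans (sym p) eq)
  orientedCircuit-balanced false (u , vu , eq) with arcCircuit-witness (Graph.sym H vu)
  ... | a , (_ , j , _ , _ , j↦v) , p with outArc (D a) j↦v
  ...   | w , v↦w = let vw = HasArc⇒Adj (D a) v↦w in
    w , vw , trans (arcCircuit-correct vw v↦w) (trans (sym p) eq)

  side-flip : ∀ b {u v} → Adj H u v → b xor side v ≡ not (b xor side u)
  side-flip b {u} {v} uv = trans (cong (b xor_) (¬-not (side-proper v u (Graph.sym H uv))))
                                 (sym (not-distribʳ-xor b (side u)))

  colouring : Bool → EdgeColoring H (suc m)
  colouring b = record
    { col    = λ u v → orientedCircuit (b xor side u) u v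
    ; colSym = λ u v uv → trans (orientedCircuit-flip (b xor side u) u v)
                                 (cong (λ x → orientedCircuit x v u) (sym (side-flip b uv)))
    ; proper = λ u v w uv uw v≢w → v≢w ∘ orientedCircuit-injective (b xor side u) uv uw
    }

  recolour : ∀ b v k → ColorAt (colouring b) v k → ColorAt (colouring (not b)) v k
  recolour b v k = subst (λ x → ∃[ u ] (Adj H v u × orientedCircuit x v u ≡ k))
                         (not-distribˡ-xor b (side v)) ∘ orientedCircuit-balanced (b xor side v)

  twoSimultaneous : TwoSimultaneousEdgeColoring H
  twoSimultaneous = suc m , colouring false , colouring true ,
    (λ v k → mk⇔ (recolour false v k) (recolour true v k)) ,
    (λ u v uv → orientedCircuit-not (side u) uv)

bipartite-twoSimultaneous : ∀ {H} → Bipartite H → OrientedCDC H → TwoSimultaneousEdgeColoring H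
bipartite-twoSimultaneous (side , side-proper) (m , D , cover) =
  BipartiteCover.twoSimultaneous side side-proper m D cover

↑ˡ≢↑ʳ : ∀ {m n} (i : Fin m) (j : Fin n) → i ↑ˡ n ≢ m ↑ʳ j
↑ˡ≢↑ʳ {m} {n} i j eq
  with () ← trans (sym (splitAt-↑ˡ m i n)) (trans (cong (splitAt m) eq) (splitAt-↑ʳ m n j))

module Join {G : Graph} (C : Circuit G) {l₁ l₂ : ℕ} where

  joinCol : EdgeColoring (circuitGraph C) l₁ → EdgeColoring (G ∖E C) l₂ →
            Fin (n G) → Fin (n G) → Fin (l₁ + l₂)
  joinCol c d u v with hasEdge? C u v
  ... | yes _ = col c u v ↑ˡ l₂
  ... | no _  = l₁ ↑ʳ col d u v

  module _ (c : EdgeColoring (circuitGraph C) l₁) (d : EdgeColoring (G ∖E C) l₂) where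

    joinCol-on : ∀ {u v} → HasEdge C u v → joinCol c d u v ≡ col c u v ↑ˡ l₂
    joinCol-on {u} {v} e with hasEdge? C u v
    ... | yes _ = refl
    ... | no ¬e = contradiction e ¬e

    joinCol-off : ∀ {u v} → ¬ HasEdge C u v → joinCol c d u v ≡ l₁ ↑ʳ col d u v
    joinCol-off {u} {v} ¬e with hasEdge? C u v
    ... | yes e = contradiction e ¬e
    ... | no _  = refl

    joinCol-sym : ∀ u v → Adj G u v → joinCol c d u v ≡ joinCol c d v u
    joinCol-sym u v uv with hasEdge? C u v | hasEdge? C v u
    ... | yes e | yes _  = cong (_↑ˡ l₂) (colSym c u v e)
    ... | yes e | no ¬e  = contradiction (swap e) ¬e
    ... | no ¬e | yes e  = contradiction (swap e) ¬e
    ... | no ¬e | no _   = cong (l₁ ↑ʳ_) (colSym d u v (uv , ¬e))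

    joinCol-proper : ∀ u v w → Adj G u v → Adj G u w → v ≢ w → joinCol c d u v ≢ joinCol c d u w
    joinCol-proper u v w uv uw v≢w with hasEdge? C u v | hasEdge? C u w
    ... | yes e  | yes e′  = proper c u v w e e′ v≢w ∘ ↑ˡ-injective l₂ _ _
    ... | yes _  | no _    = ↑ˡ≢↑ʳ _ _
    ... | no _   | yes _   = ↑ˡ≢↑ʳ _ _ ∘ sym
    ... | no ¬e  | no ¬e′  = proper d u v w (uv , ¬e) (uw , ¬e′) v≢w ∘ ↑ʳ-injective l₁ _ _

    join : EdgeColoring G (l₁ + l₂)
    join = record { col = joinCol c d ; colSym = joinCol-sym ; proper = joinCol-proper }

  join-colours : ∀ {c c′ d d′} →
    (∀ v k → ColorAt c v k → ColorAt c′ v k) → (∀ v k → ColorAt d v k → ColorAt d′ v k) →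
    ∀ v k → ColorAt (join c d) v k → ColorAt (join c′ d′) v k
  join-colours {c} {c′} {d} {d′} onC offC v k (u , vu , eq) with hasEdge? C v u
  ... | yes e =
    let w , e′ , eq′ = onC v (col c v u) (u , e , refl)
    in  w , HasEdge⇒Adj C e′ , trans (joinCol-on c′ d′ e′) (trans (cong (_↑ˡ l₂) eq′) eq)
  ... | no ¬e =
    let w , (vw , ¬e′) , eq′ = offC v (col d v u) (u , (vu , ¬e) , refl)
    in  w , vw , trans (joinCol-off c′ d′ ¬e′) (trans (cong (l₁ ↑ʳ_) eq′) eq)

  join-distinct : ∀ {c c′ d d′} →
    (∀ u v → HasEdge C u v → col c u v ≢ col c′ u v) →
    (∀ u v → Adj (G ∖E C) u v → col d u v ≢ col d′ u v) →
    ∀ u v → Adj G u v → col (join c d) u v ≢ col (join c′ d′) u v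
  join-distinct onC offC u v uv with hasEdge? C u v
  ... | yes e = onC u v e ∘ ↑ˡ-injective l₂ _ _
  ... | no ¬e = offC u v (uv , ¬e) ∘ ↑ʳ-injective l₁ _ _

circuit∪complement-twoSimultaneous : ∀ {G} (C : Circuit G) →
  TwoSimultaneousEdgeColoring (circuitGraph C) → TwoSimultaneousEdgeColoring (G ∖E C) →
  TwoSimultaneousEdgeColoring G
circuit∪complement-twoSimultaneous C
  (l₁ , c , c′ , same₁ , distinct₁) (l₂ , d , d′ , same₂ , distinct₂) =
  l₁ + l₂ , join c d , join c′ d′ ,
  (λ v k → mk⇔ (join-colours (to ∘₂ same₁) (to ∘₂ same₂) v k)
                (join-colours (from ∘₂ same₁) (from ∘₂ same₂) v k)) ,
  join-distinct distinct₁ distinct₂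
  where open Join C

theorem3p5 : (G : Graph) (C : EvenHamCircuit G) →
    Bipartite (G ∖E circ C) → OrientedCDC (G ∖E circ C) →
    TwoSimultaneousEdgeColoring G
theorem3p5 G C bipartite cover =
  circuit∪complement-twoSimultaneous (circ C)
    (EvenCircuit.twoSimultaneous (circ C) (even C))
    (bipartite-twoSimultaneous bipartite cover)
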